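{- Let $n\ge 1$ and let $P$ be the directed path $v_1v_2\dots v_n$ (arcs $v_iv_{i+1}$ for $1\le i\le n-1$). Then $\chi_d(P)=n$.
   Context: For a digraph $D$ and $v\in V(D)$, $N^+(v)=\{u: vu\in A(D)\}$. A dominator coloring of $D$ is a partition of $V(D)$ into color classes such that (i) it is a proper coloring of the underlying graph (adjacent vertices receive different colors), and (ii) every vertex $v$ with at least one out-neighbor dominates some color class, i.e., there is a color class $C$ with $C\subseteq N^+(v)$; vertices of out-degree $0$ are not required to dominate anything. $\chi_d(D)$ is the minimum number of color classes in a dominator coloring of $D$. -}

module Defs where

open import Data.Nat using (ℕ; suc; _≤_)
open import Data.Fin using (Fin; toℕ)
open import Data.Product using (Σ; ∃; _×_)
open import Relation.Binary.PropositionalEquality using (_≡_; _≢_)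
open import Relation.Nullary using (¬_)

record Digraph (n : ℕ) : Set₁ where
  field
    Arc : Fin n → Fin n → Set

open Digraph public

-- A partition of V(D) into k color classes: a surjective map c : Fin n → Fin k
-- (surjectivity = every color class is nonempty).
record DominatorColoring {n : ℕ} (D : Digraph n) (k : ℕ) : Set where
  field
    color      : Fin n → Fin k
    surjective : ∀ (j : Fin k) → ∃ λ v → color v ≡ j
    proper     : ∀ u v → Arc D u v → color u ≢ color v
    dominates  : ∀ v → (∃ λ u → Arc D v u) →
                 ∃ λ (j : Fin k) → ∀ u → color u ≡ j → Arc D v u

DominatorChromaticNumber : ∀ {n} → Digraph n → ℕ → Set
DominatorChromaticNumber D m =
  DominatorColoring D m × (∀ k → DominatorColoring D k → m ≤ k)

-- The directed path v₁ v₂ … vₙ: arcs vᵢ vᵢ₊₁ (indices 0..n-1 here).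
DirectedPath : (n : ℕ) → Digraph n
DirectedPath n = record { Arc = λ u v → suc (toℕ u) ≡ toℕ v }

module Submission where

-- Proof idea: the identity colouring is a dominator colouring of any loopless
-- digraph, so χ_d(P) ≤ n.  Conversely, vᵢ has the single out-neighbour vᵢ₊₁,
-- so the class vᵢ dominates is {vᵢ₊₁}; every vertex but v₁ is thus alone in
-- its class, which forces all n classes to be distinct.

open import Defs
open import Data.Nat using (ℕ; _≥_)
open import Data.Nat.Properties using (1+n≢n)
open import Data.Fin using (Fin; zero; suc; toℕ; inject₁)
open import Data.Fin.Properties using (toℕ-injective; toℕ-inject₁; injective⇒≤)
open import Data.Product using (_,_; proj₁; proj₂)
open import Function.Definitions using (Injective)
open import Relation.Binary.PropositionalEquality
  using (_≡_; refl; sym; trans; cong; subst)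
open import Relation.Nullary using (¬_)

identityColoring : ∀ {n} (D : Digraph n) → (∀ v → ¬ Arc D v v) →
                   DominatorColoring D n
identityColoring D loopless = record
  { color      = λ v → v
  ; surjective = λ j → j , refl
  ; proper     = λ u v uv u≡v → loopless u (subst (Arc D u) (sym u≡v) uv)
  ; dominates  = λ v (w , vw) → w , λ u u≡w → subst (Arc D v) (sym u≡w) vw
  }

module _ {n k} {D : Digraph n} (C : DominatorColoring D k) where
  open DominatorColoring C

  uniqueOutNeighbour⇒singletonClass :
    ∀ {v w} → Arc D v w → (∀ {u} → Arc D v u → u ≡ w) →
    ∀ u → color u ≡ color w → u ≡ w
  uniqueOutNeighbour⇒singletonClass {v} {w} vw unique u cu≡cw =
    unique (dominated u (trans cu≡cw cw≡j))
    where
    j = proj₁ (dominates v (w , vw))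
    dominated : ∀ u → color u ≡ j → Arc D v u
    dominated = proj₂ (dominates v (w , vw))
    -- j is nonempty, and its members are out-neighbours of v, i.e. equal to w.
    cw≡j : color w ≡ j
    cw≡j with surjective j
    ... | x , cx≡j = subst (λ y → color y ≡ j) (unique (dominated x cx≡j)) cx≡j

directedPath-loopless : ∀ {n} (v : Fin n) → ¬ Arc (DirectedPath n) v v
directedPath-loopless v = 1+n≢n

directedPath-functional : ∀ {n} {v u w : Fin n} →
  Arc (DirectedPath n) v w → Arc (DirectedPath n) v u → u ≡ w
directedPath-functional vw vu = toℕ-injective (trans (sym vu) vw)

directedPath-predecessorArc : ∀ {n} (i : Fin n) →
  Arc (DirectedPath (ℕ.suc n)) (inject₁ i) (suc i)
directedPath-predecessorArc i = cong ℕ.suc (toℕ-inject₁ i)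

dominatorColoring-directedPath-injective :
  ∀ {n k} (C : DominatorColoring (DirectedPath n) k) →
  Injective _≡_ _≡_ (DominatorColoring.color C)
dominatorColoring-directedPath-injective C {zero}  {zero}  _     = refl
dominatorColoring-directedPath-injective C {suc i} {b}     cs≡cb =
  sym (uniqueOutNeighbour⇒singletonClass C (directedPath-predecessorArc i)
         (directedPath-functional (directedPath-predecessorArc i)) b (sym cs≡cb))
dominatorColoring-directedPath-injective C {a}     {suc j} ca≡cs =
  uniqueOutNeighbour⇒singletonClass C (directedPath-predecessorArc j)
    (directedPath-functional (directedPath-predecessorArc j)) a ca≡cs

proposition1 : ∀ (n : ℕ) → n ≥ 1 → DominatorChromaticNumber (DirectedPath n) n
proposition1 n _ =
  identityColoring (DirectedPath n) directedPath-loopless ,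
  λ k C → injective⇒≤ (dominatorColoring-directedPath-injective C)
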